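{- Let $D$ be an oriented cactus, $C$ a cycle of $D$, $u,v \in V(D)$ and $P$ a directed $(u,v)$-path in $D$. (1) If some $w \in V(P)$ belongs to no cycle of $D$, then every directed $(u,v)$-path in $D$ contains $w$. (2) Suppose $P \cap C$ is the directed path $(w_1,\dots,w_q)$ with $q \geq 2$. Then for every directed $(u,v)$-path $P^*$ in $D$, $P^* \cap C$ is a directed $(w_1,w_q)$-path.
   Context: An oriented cactus is an orientation of a finite simple graph in which every block is an edge or a cycle. A cycle of $D$ is a subgraph whose underlying graph is a cycle (its arcs may be oriented arbitrarily). -}

module Defs where

open import Data.Nat using (ℕ; zero; suc; _≤_)
open import Data.Fin using (Fin; zero; suc; toℕ; inject₁; fromℕ; _≟_)
open import Data.Bool using (Bool; true; false; T; not; _∧_)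
open import Data.Product using (Σ; ∃; ∃-syntax; _×_; _,_)
open import Data.Sum using (_⊎_)
open import Relation.Binary.PropositionalEquality using (_≡_; _≢_)
open import Relation.Nullary using (¬_)
open import Relation.Nullary.Decidable using (⌊_⌋)
open import Function.Definitions using (Injective)
open import Function.Bundles using (_⇔_)

Digraph : ℕ → Set
Digraph n = Fin n → Fin n → Bool

VSet : ℕ → Set
VSet n = Fin n → Bool

_⊆ᵥ_ : ∀ {n} → VSet n → VSet n → Set
S ⊆ᵥ S' = ∀ x → T (S x) → T (S' x)

remove : ∀ {n} → VSet n → Fin n → VSet n
remove S x y = S y ∧ not ⌊ y ≟ x ⌋

Consec : ∀ {k} → Fin k → Fin k → Set
Consec {k} i j = (suc (toℕ i) ≡ toℕ j) ⊎ (suc (toℕ i) ≡ k × toℕ j ≡ 0)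

module _ {n : ℕ} (D : Digraph n) where

  Arc : Fin n → Fin n → Set
  Arc x y = T (D x y)

  Oriented : Set
  Oriented = (∀ x → ¬ Arc x x) × (∀ x y → Arc x y → ¬ Arc y x)

  Edge : Fin n → Fin n → Set
  Edge x y = Arc x y ⊎ Arc y x

  data Walk (S : VSet n) : Fin n → Fin n → Set where
    [_]  : ∀ {x} → T (S x) → Walk S x x
    step : ∀ {x y z} → T (S x) → Edge x y → Walk S y z → Walk S x z

  Connected : VSet n → Set
  Connected S = ∀ x y → T (S x) → T (S y) → Walk S x y

  Nonseparable : VSet n → Set
  Nonseparable S = (∃[ x ] T (S x)) × Connected S
                 × (∀ x → T (S x) → Connected (remove S x))

  IsBlock : VSet n → Set
  IsBlock S = Nonseparable S × (∀ S' → S ⊆ᵥ S' → Nonseparable S' → S' ⊆ᵥ S)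

  IsEdgeBlock : VSet n → Set
  IsEdgeBlock S = ∃[ x ] ∃[ y ] (x ≢ y × Edge x y × (∀ z → T (S z) ⇔ (z ≡ x ⊎ z ≡ y)))

  IsCycleBlock : VSet n → Set
  IsCycleBlock S = ∃[ k ] (3 ≤ k × Σ (Fin k → Fin n) λ c →
                     Injective _≡_ _≡_ c
                   × (∀ z → T (S z) ⇔ (∃[ i ] c i ≡ z))
                   × (∀ i j → Edge (c i) (c j) ⇔ (Consec i j ⊎ Consec j i)))

  OrientedCactus : Set
  OrientedCactus = Oriented × (∀ S → IsBlock S → IsEdgeBlock S ⊎ IsCycleBlock S)

  record Cycle : Set where
    field
      len   : ℕ
      3≤len : 3 ≤ len
      vtx   : Fin len → Fin n
      inj   : Injective _≡_ _≡_ vtx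
      edges : ∀ i j → Consec i j → Edge (vtx i) (vtx j)

  OnCycle : Cycle → Fin n → Set
  OnCycle C x = ∃[ i ] Cycle.vtx C i ≡ x

  CycleArc : Cycle → Fin n → Fin n → Set
  CycleArc C x y = Arc x y × (∃[ i ] ∃[ j ] (Consec i j
                     × ((Cycle.vtx C i ≡ x × Cycle.vtx C j ≡ y)
                       ⊎ (Cycle.vtx C i ≡ y × Cycle.vtx C j ≡ x))))

  -- a directed path vtx 0 → vtx 1 → ... → vtx len  (len + 1 distinct vertices)
  record DPath : Set where
    field
      len  : ℕ
      vtx  : Fin (suc len) → Fin n
      inj  : Injective _≡_ _≡_ vtx
      arcs : ∀ (i : Fin len) → Arc (vtx (inject₁ i)) (vtx (suc i))

  start : DPath → Fin n
  start P = DPath.vtx P zero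

  end : DPath → Fin n
  end P = DPath.vtx P (fromℕ (DPath.len P))

  OnPath : DPath → Fin n → Set
  OnPath P x = ∃[ i ] DPath.vtx P i ≡ x

  PathArc : DPath → Fin n → Fin n → Set
  PathArc P x y = ∃[ i ] (DPath.vtx P (inject₁ i) ≡ x × DPath.vtx P (suc i) ≡ y)

  -- the subgraph P ∩ C (common vertices, common arcs) equals the path Q
  MeetIs : DPath → Cycle → DPath → Set
  MeetIs P C Q = (∀ x → (OnPath P x × OnCycle C x) ⇔ OnPath Q x)
               × (∀ x y → (PathArc P x y × CycleArc C x y) ⇔ PathArc Q x y)

module Submission where

-- (1) If w ∈ P lies on no cycle, every directed (u,v)-path P* passes through w.  Otherwise the
--     two neighbours of w on P are joined by a walk avoiding w (back along P to u, along P* to v,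
--     back along P), and together with w this walk closes a cycle.  No cactus property is needed.
-- (2) In a cactus a vertex of a nonseparable set has at most two neighbours inside it, because the
--     set lies in a block, which is an edge or a cycle.  Applied to C, and to C with an attached
--     ear, this shows that C has no chord and no bypass (a walk outside C joining neighbours of two
--     distinct cycle vertices).  Hence every directed path decomposes as  off C ++ run on C ++ off C;
--     the run is exactly its intersection with C, and the ends of the run are the first cycle
--     vertices reached from u and from v, which are unique.

open import Data.Bool using (Bool; true; false; T; not; _∨_; T?; if_then_else_)
open import Data.Bool.Properties using (T-∨; T-∧)
open import Data.Empty using (⊥; ⊥-elim)
open import Data.Fin using (Fin; zero; suc; _≟_; toℕ; fromℕ; fromℕ<; inject₁)
import Data.Fin.Properties as Fin
open import Data.List using (List; []; _∷_; _++_; length)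
open import Data.List.Membership.Propositional using (_∈_; _∉_)
open import Data.List.Membership.Propositional.Properties using (∈-++⁺ˡ; ∈-++⁺ʳ; ∈-++⁻; ∈-∃++)
import Data.List.Membership.DecPropositional as DecMembership
open import Data.List.Relation.Unary.Any using (here; there)
open import Data.Nat using (ℕ; zero; suc; _≤_; z≤n; s≤s; _+_)
import Data.Nat.Properties as ℕ
open import Data.Product using (Σ; ∃-syntax; _×_; _,_; proj₁; proj₂)
open import Data.Sum using (_⊎_; inj₁; inj₂)
open import Data.Unit using (⊤; tt)
open import Function.Bundles using (_⇔_; mk⇔; Equivalence)
open import Function.Definitions using (Injective)
open import Relation.Binary.PropositionalEquality using (_≡_; _≢_; refl; sym; trans; cong; subst; subst₂)
open import Relation.Nullary using (¬_; Dec; yes; no)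
open import Relation.Nullary.Decidable using (_⊎-dec_; _×-dec_; ⌊_⌋; toWitness; fromWitness)

open import Defs

module Lists {A : Set} where

  Distinct : List A → Set
  Distinct []       = ⊤
  Distinct (x ∷ xs) = x ∉ xs × Distinct xs

  lastOf : A → List A → A
  lastOf x []       = x
  lastOf x (y ∷ ys) = lastOf y ys

  data Chain (R : A → A → Set) : A → List A → Set where
    []  : ∀ {x} → Chain R x []
    _∷_ : ∀ {x y ys} → R x y → Chain R y ys → Chain R x (y ∷ ys)

  data Adjacent (x y : A) : List A → Set where
    here  : ∀ {zs} → Adjacent x y (x ∷ y ∷ zs)
    there : ∀ {z zs} → Adjacent x y zs → Adjacent x y (z ∷ zs)

  distinct-++ʳ : ∀ xs {ys : List A} → Distinct (xs ++ ys) → Distinct ys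
  distinct-++ʳ []       d       = d
  distinct-++ʳ (_ ∷ xs) (_ , d) = distinct-++ʳ xs d

  distinct-++ˡ : ∀ xs {ys : List A} → Distinct (xs ++ ys) → Distinct xs
  distinct-++ˡ []       d        = tt
  distinct-++ˡ (x ∷ xs) (x∉ , d) = (λ m → x∉ (∈-++⁺ˡ m)) , distinct-++ˡ xs d

  distinct-disjoint : ∀ xs {ys : List A} {x y} → Distinct (xs ++ ys) → x ∈ xs → y ∈ ys → x ≢ y
  distinct-disjoint (_ ∷ xs) (x∉ , d) (here refl) y∈ refl = x∉ (∈-++⁺ʳ xs y∈)
  distinct-disjoint (_ ∷ xs) (x∉ , d) (there x∈) y∈ eq  = distinct-disjoint xs d x∈ y∈ eq

  distinct-snoc : ∀ {x : A} ys → Distinct ys → x ∉ ys → Distinct (ys ++ x ∷ [])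
  distinct-snoc []       d        x∉ = (λ ()) , tt
  distinct-snoc (y ∷ ys) (y∉ , d) x∉ = y∉ys++x , distinct-snoc ys d (λ m → x∉ (there m))
    where
    y∉ys++x : _ ∉ ys ++ _ ∷ []
    y∉ys++x m with ∈-++⁻ ys m
    ... | inj₁ y∈ys          = y∉ y∈ys
    ... | inj₂ (here refl)   = x∉ (here refl)

  lastOf-∈ : ∀ (x : A) ys → lastOf x ys ∈ x ∷ ys
  lastOf-∈ x []       = here refl
  lastOf-∈ x (y ∷ ys) = there (lastOf-∈ y ys)

  lastOf-++ : ∀ (x : A) ys zs → lastOf x (ys ++ zs) ≡ lastOf (lastOf x ys) zs
  lastOf-++ x []       zs = refl
  lastOf-++ x (y ∷ ys) zs = lastOf-++ y ys zs

  lastOf-middle : ∀ X {u : A} {ys m Z} → u ∷ ys ≡ X ++ m ∷ Z → lastOf u ys ≡ lastOf m Z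
  lastOf-middle []      refl = refl
  lastOf-middle (_ ∷ X) {u} refl = lastOf-++ u X (_ ∷ _)

  module _ {R : A → A → Set} where

    chain-split : ∀ {x} ys {zs} → Chain R x (ys ++ zs) → Chain R x ys × Chain R (lastOf x ys) zs
    chain-split []       c       = [] , c
    chain-split (y ∷ ys) (r ∷ c) = let c₁ , c₂ = chain-split ys c in (r ∷ c₁) , c₂

    chain-join : ∀ {x} ys {zs} → Chain R x ys → Chain R (lastOf x ys) zs → Chain R x (ys ++ zs)
    chain-join []       []       c = c
    chain-join (y ∷ ys) (r ∷ c₁) c₂ = r ∷ chain-join ys c₁ c₂

    adjacent-related : ∀ {h t x y} → Chain R h t → Adjacent x y (h ∷ t) → R x y
    adjacent-related (r ∷ c) here      = r
    adjacent-related (r ∷ c) (there a) = adjacent-related c a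

  chain-map : ∀ {R R′ : A → A → Set} → (∀ {a b} → R a b → R′ a b) → ∀ {x ys} → Chain R x ys → Chain R′ x ys
  chain-map f []      = []
  chain-map f (r ∷ c) = f r ∷ chain-map f c

  adjacent-fst : ∀ {x y : A} {L} → Adjacent x y L → x ∈ L
  adjacent-fst here      = here refl
  adjacent-fst (there a) = there (adjacent-fst a)

  adjacent-snd : ∀ {x y : A} {L} → Adjacent x y L → y ∈ L
  adjacent-snd here      = there (here refl)
  adjacent-snd (there a) = there (adjacent-snd a)

  adjacent-snd-tail : ∀ {x y h : A} {t} → Adjacent x y (h ∷ t) → y ∈ t
  adjacent-snd-tail here      = here refl
  adjacent-snd-tail (there a) = adjacent-snd a

  adjacent-++⁻ : ∀ {x y : A} xs {ys} → Adjacent x y (xs ++ ys)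
               → Adjacent x y xs ⊎ Adjacent x y ys ⊎ (x ∈ xs × y ∈ ys)
  adjacent-++⁻ []                   a         = inj₂ (inj₁ a)
  adjacent-++⁻ (_ ∷ []) {_ ∷ _}     here      = inj₂ (inj₂ (here refl , here refl))
  adjacent-++⁻ (_ ∷ [])             (there a) = inj₂ (inj₁ a)
  adjacent-++⁻ (_ ∷ _ ∷ xs)         here      = inj₁ here
  adjacent-++⁻ (_ ∷ z ∷ xs)         (there a) with adjacent-++⁻ (z ∷ xs) a
  ... | inj₁ a′                = inj₁ (there a′)
  ... | inj₂ (inj₁ a′)         = inj₂ (inj₁ a′)
  ... | inj₂ (inj₂ (x∈ , y∈))  = inj₂ (inj₂ (there x∈ , y∈))

  adjacent-++ˡ : ∀ {x y : A} {xs} ys → Adjacent x y xs → Adjacent x y (xs ++ ys)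
  adjacent-++ˡ ys here      = here
  adjacent-++ˡ ys (there a) = there (adjacent-++ˡ ys a)

  adjacent-++ʳ : ∀ {x y : A} xs {ys} → Adjacent x y ys → Adjacent x y (xs ++ ys)
  adjacent-++ʳ []       a = a
  adjacent-++ʳ (_ ∷ xs) a = there (adjacent-++ʳ xs a)

  last-has-no-successor : ∀ {h : A} {t s} → Distinct (h ∷ t) → Adjacent (lastOf h t) s (h ∷ t) → ⊥
  last-has-no-successor {t = t₁ ∷ t} (h∉ , d) here      = h∉ (lastOf-∈ t₁ t)
  last-has-no-successor {t = t₁ ∷ t} (h∉ , d) (there a) = last-has-no-successor d a

  head-has-no-predecessor : ∀ {h : A} {t p} → Distinct (h ∷ t) → Adjacent p h (h ∷ t) → ⊥
  head-has-no-predecessor (h∉ , _) a = h∉ (adjacent-snd-tail a)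

  ∈-predecessor : ∀ {x h : A} {t} → x ∈ h ∷ t → x ≡ h ⊎ ∃[ p ] Adjacent p x (h ∷ t)
  ∈-predecessor (here e) = inj₁ e
  ∈-predecessor {t = _ ∷ t} (there m) with ∈-predecessor m
  ... | inj₁ refl    = inj₂ (_ , here)
  ... | inj₂ (p , a) = inj₂ (p , there a)

  ∈-successor : ∀ {x h : A} {t} → x ∈ h ∷ t → x ≡ lastOf h t ⊎ ∃[ s ] Adjacent x s (h ∷ t)
  ∈-successor {t = []}     (here e)    = inj₁ e
  ∈-successor {t = t₁ ∷ t} (here refl) = inj₂ (t₁ , here)
  ∈-successor {t = _ ∷ t}  (there m) with ∈-successor m
  ... | inj₁ e       = inj₁ e
  ... | inj₂ (s , a) = inj₂ (s , there a)

  ∈-prefix : ∀ {v c : A} Y₁ {Y₂} → v ∈ Y₁ ++ c ∷ [] → v ∈ Y₁ ++ c ∷ Y₂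
  ∈-prefix Y₁ m with ∈-++⁻ Y₁ m
  ... | inj₁ m′         = ∈-++⁺ˡ m′
  ... | inj₂ (here v≡c) = ∈-++⁺ʳ Y₁ (here v≡c)

module Sequences {A : Set} where
  open Lists {A}

  tailList : ∀ m → (Fin (suc m) → A) → List A
  tailList zero    f = []
  tailList (suc m) f = f (suc zero) ∷ tailList m (λ i → f (suc i))

  seq-∈⁺ : ∀ m (f : Fin (suc m) → A) {x} → ∃[ i ] f i ≡ x → x ∈ f zero ∷ tailList m f
  seq-∈⁺ m       f (zero  , e) = here (sym e)
  seq-∈⁺ (suc m) f (suc i , e) = there (seq-∈⁺ m (λ j → f (suc j)) (i , e))

  seq-∈⁻ : ∀ m (f : Fin (suc m) → A) {x} → x ∈ f zero ∷ tailList m f → ∃[ i ] f i ≡ x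
  seq-∈⁻ m       f (here e)  = zero , sym e
  seq-∈⁻ (suc m) f (there p) = let i , e = seq-∈⁻ m (λ j → f (suc j)) p in suc i , e

  seq-adjacent⁺ : ∀ m (f : Fin (suc m) → A) {x y} → ∃[ i ] (f (inject₁ i) ≡ x × f (suc i) ≡ y)
                → Adjacent x y (f zero ∷ tailList m f)
  seq-adjacent⁺ (suc m) f (zero  , refl , refl) = here
  seq-adjacent⁺ (suc m) f (suc i , e)           = there (seq-adjacent⁺ m (λ j → f (suc j)) (i , e))

  seq-adjacent⁻ : ∀ m (f : Fin (suc m) → A) {x y} → Adjacent x y (f zero ∷ tailList m f)
                → ∃[ i ] (f (inject₁ i) ≡ x × f (suc i) ≡ y)
  seq-adjacent⁻ zero    f (there ())
  seq-adjacent⁻ (suc m) f here      = zero , refl , refl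
  seq-adjacent⁻ (suc m) f (there a) = let i , e = seq-adjacent⁻ m (λ j → f (suc j)) a in suc i , e

  seq-distinct : ∀ m (f : Fin (suc m) → A) → Injective _≡_ _≡_ f → Distinct (f zero ∷ tailList m f)
  seq-distinct zero    f inj = (λ ()) , tt
  seq-distinct (suc m) f inj = f0∉ , seq-distinct m (λ j → f (suc j)) (λ e → Fin.suc-injective (inj e))
    where
    f0∉ : f zero ∉ tailList (suc m) f
    f0∉ m′ with seq-∈⁻ m (λ j → f (suc j)) m′
    ... | i , e with inj e
    ...   | ()

  seq-chain : ∀ m (f : Fin (suc m) → A) {R : A → A → Set} → (∀ i → R (f (inject₁ i)) (f (suc i)))
            → Chain R (f zero) (tailList m f)
  seq-chain zero    f r = []
  seq-chain (suc m) f r = r zero ∷ seq-chain m (λ j → f (suc j)) (λ i → r (suc i))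

  seq-last : ∀ m (f : Fin (suc m) → A) → lastOf (f zero) (tailList m f) ≡ f (fromℕ m)
  seq-last zero    f = refl
  seq-last (suc m) f = seq-last m (λ j → f (suc j))

  fromList : (x : A) (ys : List A) → Fin (suc (length ys)) → A
  fromList x ys       zero    = x
  fromList x (y ∷ ys) (suc i) = fromList y ys i

  tailList-fromList : ∀ x ys → tailList (length ys) (fromList x ys) ≡ ys
  tailList-fromList x []       = refl
  tailList-fromList x (y ∷ ys) = cong (y ∷_) (tailList-fromList y ys)

  fromList-∈ : ∀ x ys i → fromList x ys i ∈ x ∷ ys
  fromList-∈ x ys       zero    = here refl
  fromList-∈ x (y ∷ ys) (suc i) = there (fromList-∈ y ys i)

  fromList-injective : ∀ x ys → Distinct (x ∷ ys) → Injective _≡_ _≡_ (fromList x ys)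
  fromList-injective x ys       d        {zero}  {zero}  e = refl
  fromList-injective x (y ∷ ys) (x∉ , d) {zero}  {suc j} e = ⊥-elim (x∉ (subst (_∈ y ∷ ys) (sym e) (fromList-∈ y ys j)))
  fromList-injective x (y ∷ ys) (x∉ , d) {suc i} {zero}  e = ⊥-elim (x∉ (subst (_∈ y ∷ ys) e (fromList-∈ y ys i)))
  fromList-injective x (y ∷ ys) (x∉ , d) {suc i} {suc j} e = cong suc (fromList-injective y ys d e)

  fromList-steps : ∀ {R : A → A → Set} x ys → Chain R x ys
                 → ∀ (i : Fin (length ys)) → R (fromList x ys (inject₁ i)) (fromList x ys (suc i))
  fromList-steps x (y ∷ ys) (r ∷ c) zero    = r
  fromList-steps x (y ∷ ys) (r ∷ c) (suc i) = fromList-steps y ys c i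

  fromList-consecutive : ∀ {R : A → A → Set} x ys → Chain R x ys
                       → ∀ (i j : Fin (suc (length ys))) → suc (toℕ i) ≡ toℕ j → R (fromList x ys i) (fromList x ys j)
  fromList-consecutive x (y ∷ ys) (r ∷ c) zero    (suc zero) e = r
  fromList-consecutive x (y ∷ ys) (r ∷ c) (suc i) (suc j)    e = fromList-consecutive y ys c i j (ℕ.suc-injective e)

  fromList-last : ∀ x ys (i : Fin (suc (length ys))) → toℕ i ≡ length ys → fromList x ys i ≡ lastOf x ys
  fromList-last x []       zero    e = refl
  fromList-last x (y ∷ ys) (suc i) e = fromList-last y ys i (ℕ.suc-injective e)

T-not⇒¬T : ∀ {b} → T (not b) → ¬ T b
T-not⇒¬T {true}  () _
T-not⇒¬T {false} _  ()

¬T⇒T-not : ∀ {b} → ¬ T b → T (not b)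
¬T⇒T-not {true}  ¬t = ¬t tt
¬T⇒T-not {false} ¬t = tt

module Walks {n : ℕ} (D : Digraph n) where
  open Lists
  open DecMembership (_≟_ {n}) using (_∈?_)

  edge-sym : ∀ {x y} → Edge D x y → Edge D y x
  edge-sym (inj₁ a) = inj₂ a
  edge-sym (inj₂ a) = inj₁ a

  listSet : List (Fin n) → VSet n
  listSet L x = ⌊ x ∈? L ⌋

  listSet⁺ : ∀ {L x} → x ∈ L → T (listSet L x)
  listSet⁺ = fromWitness

  listSet⁻ : ∀ {L x} → T (listSet L x) → x ∈ L
  listSet⁻ = toWitness

  _∪_ : VSet n → VSet n → VSet n
  (S ∪ S′) x = S x ∨ S′ x

  ∪⁺ˡ : ∀ {S S′ x} → T (S x) → T ((S ∪ S′) x)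
  ∪⁺ˡ t = Equivalence.from T-∨ (inj₁ t)

  ∪⁺ʳ : ∀ {S S′ x} → T (S′ x) → T ((S ∪ S′) x)
  ∪⁺ʳ t = Equivalence.from T-∨ (inj₂ t)

  ∪⁻ : ∀ {S S′ x} → T ((S ∪ S′) x) → T (S x) ⊎ T (S′ x)
  ∪⁻ = Equivalence.to T-∨

  remove⁺ : ∀ {S : VSet n} {r y} → T (S y) → y ≢ r → T (remove S r y)
  remove⁺ {S} {r} {y} s y≢r = Equivalence.from (T-∧ {S y} {not ⌊ y ≟ r ⌋}) (s , T-not-≢ y≢r)
    where
    T-not-≢ : y ≢ r → T (not ⌊ y ≟ r ⌋)
    T-not-≢ y≢r with y ≟ r
    ... | yes y≡r = y≢r y≡r
    ... | no  _   = tt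

  remove⁻ : ∀ {S : VSet n} {r y} → T (remove S r y) → T (S y) × y ≢ r
  remove⁻ {S} {r} {y} t with Equivalence.to (T-∧ {S y} {not ⌊ y ≟ r ⌋}) t
  ... | s , t′ = s , ≢-from-T-not t′
    where
    ≢-from-T-not : T (not ⌊ y ≟ r ⌋) → y ≢ r
    ≢-from-T-not t′ with y ≟ r
    ... | yes _   = ⊥-elim t′
    ... | no  y≢r = y≢r

  walk-start : ∀ {S x y} → Walk D S x y → T (S x)
  walk-start [ s ]        = s
  walk-start (step s e w) = s

  walk-end : ∀ {S x y} → Walk D S x y → T (S y)
  walk-end [ s ]        = s
  walk-end (step s e w) = walk-end w

  walk-mono : ∀ {S S′ x y} → S ⊆ᵥ S′ → Walk D S x y → Walk D S′ x y
  walk-mono f [ s ]        = [ f _ s ]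
  walk-mono f (step s e w) = step (f _ s) e (walk-mono f w)

  _++ʷ_ : ∀ {S x y z} → Walk D S x y → Walk D S y z → Walk D S x z
  [ s ]        ++ʷ w′ = w′
  step s e w   ++ʷ w′ = step s e (w ++ʷ w′)

  reverseʷ : ∀ {S x y} → Walk D S x y → Walk D S y x
  reverseʷ [ s ]        = [ s ]
  reverseʷ (step s e w) = reverseʷ w ++ʷ step (walk-start w) (edge-sym e) [ s ]

  chainWalk : ∀ {S x ys} → Chain (Edge D) x ys → (∀ z → z ∈ x ∷ ys → T (S z)) → Walk D S x (lastOf x ys)
  chainWalk []      inS = [ inS _ (here refl) ]
  chainWalk (e ∷ c) inS = step (inS _ (here refl)) e (chainWalk c (λ z m → inS z (there m)))

  chain-suffix : ∀ {h t x} → Chain (Edge D) h t → x ∈ h ∷ t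
    → Σ (List (Fin n)) λ Y → Chain (Edge D) x Y × lastOf x Y ≡ lastOf h t
      × (∀ z → z ∈ x ∷ Y → z ∈ h ∷ t) × (Distinct (h ∷ t) → Distinct (x ∷ Y))
  chain-suffix {t = t} c (here refl) = t , c , refl , (λ z m → m) , (λ d → d)
  chain-suffix (e ∷ c) (there m) with chain-suffix c m
  ... | Y , c′ , l , sub , dist = Y , c′ , l , (λ z m′ → there (sub z m′)) , (λ d → dist (proj₂ d))

  walk→path : ∀ {S x y} → Walk D S x y
    → Σ (List (Fin n)) λ zs → Chain (Edge D) x zs × lastOf x zs ≡ y × Distinct (x ∷ zs)
      × (∀ z → z ∈ x ∷ zs → T (S z))
  walk→path [ s ] = [] , [] , refl , ((λ ()) , tt) , λ { z (here refl) → s }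
  walk→path {x = x} (step {y = y} s e w) with walk→path w
  ... | zs , c , l , d , inS with x ∈? (y ∷ zs)
  ...   | no x∉ = (y ∷ zs) , (e ∷ c) , l , (x∉ , d) , λ { z (here refl) → s ; z (there m) → inS z m }
  ...   | yes x∈ with chain-suffix c x∈
  ...     | Y , c′ , l′ , sub , dist = Y , c′ , trans l′ l , dist d , λ z m → inS z (sub z m)

  walkToLast : ∀ {U h t} Y₁ {z Y₂} → Chain (Edge D) h t → h ∷ t ≡ Y₁ ++ z ∷ Y₂
    → (∀ v → v ∈ z ∷ Y₂ → T (U v)) → Walk D U z (lastOf h t)
  walkToLast []            c       refl inU = chainWalk c inU
  walkToLast (_ ∷ [])      (e ∷ c) refl inU = walkToLast [] c refl inU
  walkToLast (_ ∷ y ∷ Y₁)  (e ∷ c) refl inU = walkToLast (y ∷ Y₁) c refl inU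

  walkToHead : ∀ {U h t} Y₁ {z Y₂} → Chain (Edge D) h t → h ∷ t ≡ Y₁ ++ z ∷ Y₂
    → (∀ v → v ∈ Y₁ ++ z ∷ [] → T (U v)) → Walk D U z h
  walkToHead []           c       refl inU = [ inU _ (here refl) ]
  walkToHead (_ ∷ [])     (e ∷ c) refl inU = step (inU _ (there (here refl))) (edge-sym e) [ inU _ (here refl) ]
  walkToHead (_ ∷ y ∷ Y₁) (e ∷ c) refl inU =
    walkToHead (y ∷ Y₁) c refl (λ v m → inU v (there m)) ++ʷ step (inU _ (there (here refl))) (edge-sym e) [ inU _ (here refl) ]

module CyclicOrder where

  consec-functional : ∀ {k} (i j₁ j₂ : Fin k) → Consec i j₁ → Consec i j₂ → j₁ ≡ j₂
  consec-functional i j₁ j₂ (inj₁ e₁)       (inj₁ e₂)       = Fin.toℕ-injective (trans (sym e₁) e₂)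
  consec-functional {k} i j₁ j₂ (inj₁ e₁)   (inj₂ (e₂ , _)) = ⊥-elim (ℕ.<-irrefl (trans (sym e₁) e₂) (Fin.toℕ<n j₁))
  consec-functional {k} i j₁ j₂ (inj₂ (e₁ , _)) (inj₁ e₂)   = ⊥-elim (ℕ.<-irrefl (trans (sym e₂) e₁) (Fin.toℕ<n j₂))
  consec-functional i j₁ j₂ (inj₂ (_ , z₁)) (inj₂ (_ , z₂)) = Fin.toℕ-injective (trans z₁ (sym z₂))

  consec-injective : ∀ {k} (i j₁ j₂ : Fin k) → Consec j₁ i → Consec j₂ i → j₁ ≡ j₂
  consec-injective i j₁ j₂ (inj₁ e₁)       (inj₁ e₂)       = Fin.toℕ-injective (ℕ.suc-injective (trans e₁ (sym e₂)))
  consec-injective i j₁ j₂ (inj₁ e₁)       (inj₂ (_ , z₂)) with trans e₁ z₂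
  ... | ()
  consec-injective i j₁ j₂ (inj₂ (_ , z₁)) (inj₁ e₂)       with trans e₂ z₁
  ... | ()
  consec-injective i j₁ j₂ (inj₂ (e₁ , _)) (inj₂ (e₂ , _)) = Fin.toℕ-injective (ℕ.suc-injective (trans e₁ (sym e₂)))

  consec-asymmetric : ∀ {k} → 3 ≤ k → {i j : Fin k} → Consec i j → Consec j i → ⊥
  consec-asymmetric 3≤k c₁ c₂ = no-2-cycle 3≤k c₁ c₂
    where
    no-2-cycle : ∀ {k a b} → 3 ≤ k → (suc a ≡ b ⊎ suc a ≡ k × b ≡ 0) → (suc b ≡ a ⊎ suc b ≡ k × a ≡ 0) → ⊥
    no-2-cycle _              (inj₁ refl)          (inj₁ e)             = ℕ.m≢1+n+m _ (sym e)
    no-2-cycle (s≤s (s≤s ())) (inj₁ refl)          (inj₂ (refl , refl))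
    no-2-cycle (s≤s (s≤s ())) (inj₂ (refl , refl)) (inj₁ refl)

  successor : ∀ {k} (i : Fin k) → ∃[ s ] Consec i s
  successor {suc k} i with suc (toℕ i) ℕ.≟ suc k
  ... | yes e  = zero , inj₂ (e , refl)
  ... | no  ne = fromℕ< i+1<k , inj₁ (sym (Fin.toℕ-fromℕ< i+1<k))
    where i+1<k = ℕ.≤∧≢⇒< (Fin.toℕ<n i) ne

  predecessor : ∀ {k} (i : Fin k) → ∃[ p ] Consec p i
  predecessor {suc k} zero    = fromℕ k , inj₂ (cong suc (Fin.toℕ-fromℕ k) , refl)
  predecessor {suc k} (suc i) = inject₁ i , inj₁ (cong suc (Fin.toℕ-inject₁ i))

  consec? : ∀ {k} (i j : Fin k) → Dec (Consec i j)
  consec? {k} i j = (suc (toℕ i) ℕ.≟ toℕ j) ⊎-dec ((suc (toℕ i) ℕ.≟ k) ×-dec (toℕ j ℕ.≟ 0))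

module Nonseparability {n : ℕ} (D : Digraph n) where
  open Lists
  open Walks D
  open DecMembership (_≟_ {n}) using (_∈?_)

  module Ear {S : VSet n} (nsS : Nonseparable D S) (a : Fin n) (I : List (Fin n)) (b : Fin n)
             (ear : Chain (Edge D) a (I ++ b ∷ [])) (dist : Distinct (a ∷ I ++ b ∷ []))
             (a∈S : T (S a)) (b∈S : T (S b)) where

    S⁺ : VSet n
    S⁺ = S ∪ listSet I

    ear⊆S⁺ : ∀ v → v ∈ a ∷ I ++ b ∷ [] → T (S⁺ v)
    ear⊆S⁺ v (here refl) = ∪⁺ˡ {S} {listSet I} a∈S
    ear⊆S⁺ v (there m) with ∈-++⁻ I m
    ... | inj₁ v∈I          = ∪⁺ʳ {S} {listSet I} (listSet⁺ v∈I)
    ... | inj₂ (here refl)  = ∪⁺ˡ {S} {listSet I} b∈S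

    S⊆S⁺ : S ⊆ᵥ S⁺
    S⊆S⁺ v s = ∪⁺ˡ {S} {listSet I} s

    split-at : ∀ {c} → c ∈ I → Σ (List (Fin n)) λ Y₁ → Σ (List (Fin n)) λ Y₂ → a ∷ I ++ b ∷ [] ≡ Y₁ ++ c ∷ Y₂
    split-at c∈I = ∈-∃++ (there (∈-++⁺ˡ c∈I))

    toBase : ∀ c → T (S⁺ c) → Σ (Fin n) λ h → T (S h) × Walk D S⁺ c h
    toBase c t with ∪⁻ {S} {listSet I} t
    ... | inj₁ s = c , s , [ t ]
    ... | inj₂ c∈I with split-at (listSet⁻ c∈I)
    ...   | Y₁ , Y₂ , eq = a , a∈S , walkToHead Y₁ ear eq (λ v m → ear⊆S⁺ v (subst (v ∈_) (sym eq) (∈-prefix Y₁ m)))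

    -- Avoiding a removed vertex r: walk along the ear towards whichever end lies on the side away from r.
    toBaseAvoiding : ∀ r c → T (remove S⁺ r c) → Σ (Fin n) λ h → T (S h) × h ≢ r × Walk D (remove S⁺ r) c h
    toBaseAvoiding r c t with remove⁻ {S⁺} t
    ... | t′ , c≢r with ∪⁻ {S} {listSet I} t′
    ...   | inj₁ s = c , s , c≢r , [ t ]
    ...   | inj₂ c∈I with split-at (listSet⁻ c∈I)
    ...     | Y₁ , Y₂ , eq with r ∈? Y₁
    ...       | yes r∈Y₁ = b , b∈S , proj₂ (remove⁻ {S⁺} (walk-end w)) , w
      where
      w : Walk D (remove S⁺ r) c b
      w = subst (Walk D _ c) (lastOf-++ a I (b ∷ []))
            (walkToLast Y₁ ear eq (λ v m → remove⁺ {S⁺} (ear⊆S⁺ v (subst (v ∈_) (sym eq) (∈-++⁺ʳ Y₁ m)))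
                                               (λ v≡r → distinct-disjoint Y₁ (subst Distinct eq dist) r∈Y₁ m (sym v≡r))))
    ...       | no r∉Y₁ = a , a∈S , proj₂ (remove⁻ {S⁺} (walk-end w)) , w
      where
      avoids : ∀ v → v ∈ Y₁ ++ c ∷ [] → v ≢ r
      avoids v m v≡r with ∈-++⁻ Y₁ m
      ... | inj₁ v∈Y₁        = r∉Y₁ (subst (_∈ Y₁) v≡r v∈Y₁)
      ... | inj₂ (here v≡c)  = c≢r (trans (sym v≡c) v≡r)
      w : Walk D (remove S⁺ r) c a
      w = walkToHead Y₁ ear eq (λ v m → remove⁺ {S⁺} (ear⊆S⁺ v (subst (v ∈_) (sym eq) (∈-prefix Y₁ m))) (avoids v m))

    ear-nonseparable : Nonseparable D S⁺
    ear-nonseparable = nonempty , connected , connected-after-removal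
      where
      S-connected : Connected D S
      S-connected = proj₁ (proj₂ nsS)
      S-2-connected : ∀ r → T (S r) → Connected D (remove S r)
      S-2-connected = proj₂ (proj₂ nsS)

      nonempty : ∃[ x ] T (S⁺ x)
      nonempty = let x , x∈S = proj₁ nsS in x , S⊆S⁺ x x∈S

      connected : Connected D S⁺
      connected c d tc td with toBase c tc | toBase d td
      ... | h , sh , w | h′ , sh′ , w′ = w ++ʷ (walk-mono S⊆S⁺ (S-connected h h′ sh sh′) ++ʷ reverseʷ w′)

      connected-after-removal : ∀ r → T (S⁺ r) → Connected D (remove S⁺ r)
      connected-after-removal r tr c d tc td with toBaseAvoiding r c tc | toBaseAvoiding r d td
      ... | h , sh , h≢r , w | h′ , sh′ , h′≢r , w′ = w ++ʷ (between ++ʷ reverseʷ w′)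
        where
        between : Walk D (remove S⁺ r) h h′
        between with T? (S r)
        ... | yes r∈S = walk-mono (λ v t → let s , v≢r = remove⁻ {S} t in remove⁺ {S⁺} (S⊆S⁺ v s) v≢r)
                                  (S-2-connected r r∈S h h′ (remove⁺ {S} sh h≢r) (remove⁺ {S} sh′ h′≢r))
        ... | no  r∉S = walk-mono (λ v s → remove⁺ {S⁺} (S⊆S⁺ v s) (λ v≡r → r∉S (subst (λ z → T (S z)) v≡r s)))
                                  (S-connected h h′ sh sh′)

  open Ear using (ear-nonseparable) public

  edge-nonseparable : ∀ {a b} → a ≢ b → Edge D a b → Nonseparable D (listSet (a ∷ b ∷ []))
  edge-nonseparable {a} {b} a≢b e = (a , listSet⁺ (here refl)) , connected , λ r _ → connected-after-removal r
    where
    ends : ∀ {x} → T (listSet (a ∷ b ∷ []) x) → x ≡ a ⊎ x ≡ b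
    ends t with listSet⁻ {a ∷ b ∷ []} t
    ... | here e′          = inj₁ e′
    ... | there (here e′)  = inj₂ e′
    joined : ∀ {U : VSet n} x y → T (U x) → T (U y) → (x ≡ a ⊎ x ≡ b) → (y ≡ a ⊎ y ≡ b) → Walk D U x y
    joined x y tx ty x∈ y∈ with x ≟ y
    ... | yes refl = [ tx ]
    ... | no x≢y with x∈ | y∈
    ...   | inj₁ refl | inj₁ refl = ⊥-elim (x≢y refl)
    ...   | inj₁ refl | inj₂ refl = step tx e [ ty ]
    ...   | inj₂ refl | inj₁ refl = step tx (edge-sym e) [ ty ]
    ...   | inj₂ refl | inj₂ refl = ⊥-elim (x≢y refl)
    connected : Connected D (listSet (a ∷ b ∷ []))
    connected x y tx ty = joined x y tx ty (ends tx) (ends ty)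
    connected-after-removal : ∀ r → Connected D (remove (listSet (a ∷ b ∷ [])) r)
    connected-after-removal r x y tx ty =
      joined x y tx ty (ends (proj₁ (remove⁻ {listSet (a ∷ b ∷ [])} tx))) (ends (proj₁ (remove⁻ {listSet (a ∷ b ∷ [])} ty)))

  card : ∀ m → (Fin m → Bool) → ℕ
  card zero    S = 0
  card (suc m) S = (if S zero then 1 else 0) + card m (λ i → S (suc i))

  card≤ : ∀ m S → card m S ≤ m
  card≤ zero    S = z≤n
  card≤ (suc m) S with S zero
  ... | true  = s≤s (card≤ m _)
  ... | false = ℕ.m≤n⇒m≤1+n (card≤ m _)

  card-mono : ∀ m (S S′ : Fin m → Bool) → (∀ x → T (S x) → T (S′ x)) → card m S ≤ card m S′
  card-mono zero    S S′ sub = z≤n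
  card-mono (suc m) S S′ sub with S zero in e | S′ zero in e′
  ... | true  | true  = s≤s (card-mono m _ _ (λ x → sub (suc x)))
  ... | true  | false = ⊥-elim (subst T e′ (sub zero (subst T (sym e) tt)))
  ... | false | true  = ℕ.m≤n⇒m≤1+n (card-mono m _ _ (λ x → sub (suc x)))
  ... | false | false = card-mono m _ _ (λ x → sub (suc x))

  card-strict : ∀ m (S S′ : Fin m → Bool) → (∀ x → T (S x) → T (S′ x)) → ∀ x → T (S′ x) → ¬ T (S x)
              → suc (card m S) ≤ card m S′
  card-strict (suc m) S S′ sub zero t′ ¬t with S zero in e | S′ zero in e′
  ... | true  | _     = ⊥-elim (¬t tt)
  ... | false | true  = s≤s (card-mono m _ _ (λ x → sub (suc x)))
  ... | false | false = ⊥-elim t′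
  card-strict (suc m) S S′ sub (suc x) t′ ¬t with S zero in e | S′ zero in e′
  ... | true  | true  = s≤s (card-strict m _ _ (λ y → sub (suc y)) x t′ ¬t)
  ... | true  | false = ⊥-elim (subst T e′ (sub zero (subst T (sym e) tt)))
  ... | false | true  = ℕ.m≤n⇒m≤1+n (card-strict m _ _ (λ y → sub (suc y)) x t′ ¬t)
  ... | false | false = card-strict m _ _ (λ y → sub (suc y)) x t′ ¬t

  -- Every nonseparable set lies in a block (stated negatively: enlarging a non-maximal
  -- nonseparable set strictly increases its size, which can happen only n times).
  NoBlockAbove : VSet n → Set
  NoBlockAbove S = ∀ B → IsBlock D B → S ⊆ᵥ B → ⊥

  private
    grow : ∀ k S → n ≤ card n S + k → Nonseparable D S → NoBlockAbove S → ⊥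
    grow k S bound nsS noBlock = noBlock S (nsS , maximal) (λ x t → t)
      where
      maximal : ∀ S′ → S ⊆ᵥ S′ → Nonseparable D S′ → S′ ⊆ᵥ S
      maximal S′ S⊆S′ nsS′ x t with T? (S x)
      ... | yes s = s
      ... | no ¬s = ⊥-elim (fuel k bound)
        where
        bigger : suc (card n S) ≤ card n S′
        bigger = card-strict n S S′ S⊆S′ x t ¬s
        fuel : ∀ k → n ≤ card n S + k → ⊥
        fuel zero     b = ℕ.<-irrefl refl (ℕ.≤-trans bigger (ℕ.≤-trans (card≤ n S′) (subst (n ≤_) (ℕ.+-identityʳ _) b)))
        fuel (suc k′) b =
          grow k′ S′ (ℕ.≤-trans b (subst (_≤ card n S′ + k′) (sym (ℕ.+-suc (card n S) k′)) (ℕ.+-monoˡ-≤ k′ bigger)))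
                                nsS′ (λ B isB S′⊆B → noBlock B isB (λ y s → S′⊆B y (S⊆S′ y s)))

  contained-in-block : ∀ S → Nonseparable D S → NoBlockAbove S → ⊥
  contained-in-block S = grow n S (ℕ.m≤n+m n (card n S))

  -- In an oriented cactus no vertex x of a nonseparable set S has three distinct neighbours in S:
  -- S lies in a block, which is an edge (only two vertices) or a chordless cycle (degree two).
  no-branching : OrientedCactus D → ∀ {S} → Nonseparable D S → ∀ {x y₁ y₂ y₃}
    → T (S x) → T (S y₁) → T (S y₂) → T (S y₃)
    → Edge D x y₁ → Edge D x y₂ → Edge D x y₃ → y₁ ≢ y₂ → y₁ ≢ y₃ → y₂ ≢ y₃ → ⊥
  no-branching (oriented , blocks) {S} nsS {x} {y₁} {y₂} {y₃} tx t₁ t₂ t₃ e₁ e₂ e₃ d₁₂ d₁₃ d₂₃ =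
    contained-in-block S nsS inBlock
    where
    open Equivalence
    open CyclicOrder
    no-loop : ∀ {y} → Edge D x y → x ≢ y
    no-loop (inj₁ a) refl = proj₁ oriented x a
    no-loop (inj₂ a) refl = proj₁ oriented x a
    three-in-two : ∀ {a b p q r : Fin n} → (p ≡ a ⊎ p ≡ b) → (q ≡ a ⊎ q ≡ b) → (r ≡ a ⊎ r ≡ b)
                 → p ≢ q → p ≢ r → q ≢ r → ⊥
    three-in-two (inj₁ refl) (inj₁ refl) _           pq pr qr = pq refl
    three-in-two (inj₂ refl) (inj₂ refl) _           pq pr qr = pq refl
    three-in-two (inj₁ refl) _           (inj₁ refl) pq pr qr = pr refl
    three-in-two (inj₂ refl) _           (inj₂ refl) pq pr qr = pr refl
    three-in-two _           (inj₁ refl) (inj₁ refl) pq pr qr = qr refl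
    three-in-two _           (inj₂ refl) (inj₂ refl) pq pr qr = qr refl
    inBlock : NoBlockAbove S
    inBlock B isB S⊆B with blocks B isB
    ... | inj₁ (a , b , _ , _ , B≡ab) =
      three-in-two (to (B≡ab x) (S⊆B x tx)) (to (B≡ab y₁) (S⊆B y₁ t₁)) (to (B≡ab y₂) (S⊆B y₂ t₂))
                   (no-loop e₁) (no-loop e₂) d₁₂
    ... | inj₂ (k , _ , c , _ , B≡c , edge⇔consec)
      with to (B≡c x) (S⊆B x tx) | to (B≡c y₁) (S⊆B y₁ t₁) | to (B≡c y₂) (S⊆B y₂ t₂) | to (B≡c y₃) (S⊆B y₃ t₃)
    ...   | i , refl | j₁ , refl | j₂ , refl | j₃ , refl
      with to (edge⇔consec i j₁) e₁ | to (edge⇔consec i j₂) e₂ | to (edge⇔consec i j₃) e₃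
    ...     | inj₁ c₁ | inj₁ c₂ | _       = d₁₂ (cong c (consec-functional i j₁ j₂ c₁ c₂))
    ...     | inj₂ c₁ | inj₂ c₂ | _       = d₁₂ (cong c (consec-injective i j₁ j₂ c₁ c₂))
    ...     | inj₁ c₁ | _       | inj₁ c₃ = d₁₃ (cong c (consec-functional i j₁ j₃ c₁ c₃))
    ...     | inj₂ c₁ | _       | inj₂ c₃ = d₁₃ (cong c (consec-injective i j₁ j₃ c₁ c₃))
    ...     | _       | inj₁ c₂ | inj₁ c₃ = d₂₃ (cong c (consec-functional i j₂ j₃ c₂ c₃))
    ...     | _       | inj₂ c₂ | inj₂ c₃ = d₂₃ (cong c (consec-injective i j₂ j₃ c₂ c₃))

module Cycles {n : ℕ} (D : Digraph n) where
  open Lists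
  open Sequences
  open Walks D
  open Nonseparability D
  open CyclicOrder

  -- The vertices f 0, …, f (k-1) of a cycle of length k ≥ 3 form a nonseparable set:
  -- the edge f 0 — f 1 plus the ear f 1, f 2, …, f (k-1), f 0.
  cycle-nonseparable : ∀ k (f : Fin k → Fin n) → 3 ≤ k → Injective _≡_ _≡_ f → (∀ i j → Consec i j → Edge D (f i) (f j))
    → Σ (VSet n) λ SC → (∀ z → T (SC z) → ∃[ i ] f i ≡ z) × (∀ i → T (SC (f i))) × Nonseparable D SC
  cycle-nonseparable (suc zero)          f (s≤s ())       inj edges
  cycle-nonseparable (suc (suc zero))    f (s≤s (s≤s ())) inj edges
  cycle-nonseparable (suc (suc (suc m))) f _ inj edges = SC , SC⁻ , SC⁺ , nsSC
    where
    v₀ v₁ : Fin n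
    v₀ = f zero
    v₁ = f (suc zero)
    I : List (Fin n)
    I = tailList (suc m) (λ i → f (suc i))
    first-edge : Edge D v₀ v₁
    first-edge = edges zero (suc zero) (inj₁ refl)
    path : Chain (Edge D) v₁ I
    path = seq-chain (suc m) (λ i → f (suc i))
                     (λ i → edges (suc (inject₁ i)) (suc (suc i)) (inj₁ (cong (λ t → suc (suc t)) (Fin.toℕ-inject₁ i))))
    closing : Edge D (lastOf v₁ I) v₀
    closing = subst (λ z → Edge D z v₀) (sym (seq-last (suc m) (λ i → f (suc i))))
                    (edges (fromℕ (suc (suc m))) zero (inj₂ (cong suc (Fin.toℕ-fromℕ _) , refl)))
    dist : Distinct (v₀ ∷ v₁ ∷ I)
    dist = seq-distinct (suc (suc m)) f inj
    v₀∉ : v₀ ∉ v₁ ∷ I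
    v₀∉ = proj₁ dist
    v₁∉ : v₁ ∉ I
    v₁∉ = proj₁ (proj₂ dist)
    SC : VSet n
    SC = listSet (v₀ ∷ v₁ ∷ []) ∪ listSet I
    earDistinct : Distinct (v₁ ∷ I ++ v₀ ∷ [])
    earDistinct = v₁∉I++v₀ , distinct-snoc I (proj₂ (proj₂ dist)) (λ m → v₀∉ (there m))
      where
      v₁∉I++v₀ : v₁ ∉ I ++ v₀ ∷ []
      v₁∉I++v₀ m with ∈-++⁻ I m
      ... | inj₁ m′       = v₁∉ m′
      ... | inj₂ (here e) = v₀∉ (here (sym e))
    nsSC : Nonseparable D SC
    nsSC = ear-nonseparable (edge-nonseparable (λ e → v₀∉ (here e)) first-edge) v₁ I v₀
             (chain-join I path (closing ∷ [])) earDistinct (listSet⁺ (there (here refl))) (listSet⁺ (here refl))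
    SC⁻ : ∀ z → T (SC z) → ∃[ i ] f i ≡ z
    SC⁻ z t with ∪⁻ {listSet (v₀ ∷ v₁ ∷ [])} {listSet I} t
    ... | inj₂ t′ = seq-∈⁻ (suc (suc m)) f (there (there (listSet⁻ {I} t′)))
    ... | inj₁ t′ with listSet⁻ {v₀ ∷ v₁ ∷ []} t′
    ...   | here e         = zero , sym e
    ...   | there (here e) = suc zero , sym e
    SC⁺ : ∀ i → T (SC (f i))
    SC⁺ i with seq-∈⁺ (suc (suc m)) f (i , refl)
    ... | here e          = ∪⁺ˡ {listSet (v₀ ∷ v₁ ∷ [])} {listSet I} (listSet⁺ (here e))
    ... | there (here e)  = ∪⁺ˡ {listSet (v₀ ∷ v₁ ∷ [])} {listSet I} (listSet⁺ (there (here e)))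
    ... | there (there m) = ∪⁺ʳ {listSet (v₀ ∷ v₁ ∷ [])} {listSet I} (listSet⁺ m)

  module _ (cactus : OrientedCactus D) (C : Cycle D) where
    open Cycle C

    private
      cycleData : Σ (VSet n) λ SC → (∀ z → T (SC z) → OnCycle D C z) × (∀ i → T (SC (vtx i))) × Nonseparable D SC
      cycleData = cycle-nonseparable len vtx 3≤len inj edges

    cycleSet : VSet n
    cycleSet = proj₁ cycleData

    cycleSet⁻ : ∀ {z} → T (cycleSet z) → OnCycle D C z
    cycleSet⁻ t = proj₁ (proj₂ cycleData) _ t

    cycleSet⁺ : ∀ {z} → OnCycle D C z → T (cycleSet z)
    cycleSet⁺ (i , refl) = proj₁ (proj₂ (proj₂ cycleData)) i

    cycleSet-nonseparable : Nonseparable D cycleSet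
    cycleSet-nonseparable = proj₂ (proj₂ (proj₂ cycleData))

    OffCycle : VSet n
    OffCycle z = not (cycleSet z)

    next prev : Fin len → Fin len
    next i = proj₁ (successor i)
    prev i = proj₁ (predecessor i)

    cycle-neighbours : ∀ i → Edge D (vtx i) (vtx (next i)) × Edge D (vtx i) (vtx (prev i)) × vtx (next i) ≢ vtx (prev i)
    cycle-neighbours i =
      edges i (next i) i→next , edge-sym (edges (prev i) i prev→i) ,
      λ e → consec-asymmetric 3≤len i→next (subst (λ t → Consec t i) (sym (inj e)) prev→i)
      where
      i→next : Consec i (next i)
      i→next = proj₂ (successor i)
      prev→i : Consec (prev i) i
      prev→i = proj₂ (predecessor i)

    no-third-neighbour : ∀ {S} → Nonseparable D S → cycleSet ⊆ᵥ S → ∀ i {z} → T (S z) → Edge D (vtx i) z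
      → z ≢ vtx (next i) → z ≢ vtx (prev i) → ⊥
    no-third-neighbour {S} nsS C⊆S i tz e z≢next z≢prev =
      let e-next , e-prev , next≢prev = cycle-neighbours i in
      no-branching cactus nsS (inS i) (inS (next i)) (inS (prev i)) tz e-next e-prev e next≢prev
                   (λ e′ → z≢next (sym e′)) (λ e′ → z≢prev (sym e′))
      where
      inS : ∀ j → T (S (vtx j))
      inS j = C⊆S _ (cycleSet⁺ (j , refl))

    -- No bypass: two distinct cycle vertices a, b are never joined through a walk avoiding C,
    -- since the resulting ear on C would give a a third neighbour in a nonseparable set.
    no-bypass : ∀ {a b x y} → OnCycle D C a → OnCycle D C b → a ≢ b → Edge D a x → Edge D y b → Walk D OffCycle x y → ⊥
    no-bypass {b = b} {x = x} (i , refl) b∈C a≢b e-ax e-yb w with walk→path w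
    ... | zs , c , last≡y , dist , off =
      no-third-neighbour (ear-nonseparable cycleSet-nonseparable (vtx i) I b ear earDistinct (cycleSet⁺ (i , refl)) (cycleSet⁺ b∈C))
                         (λ v t → ∪⁺ˡ {cycleSet} {listSet I} t) i (∪⁺ʳ {cycleSet} {listSet I} (listSet⁺ (here refl))) e-ax
                         (λ e → x-off (next i , sym e)) (λ e → x-off (prev i , sym e))
      where
      I : List (Fin n)
      I = x ∷ zs
      off-C : ∀ z → z ∈ I → ¬ T (cycleSet z)
      off-C z m = T-not⇒¬T (off z m)
      x-off : ¬ OnCycle D C x
      x-off x∈C = off-C x (here refl) (cycleSet⁺ x∈C)
      ear : Chain (Edge D) (vtx i) (I ++ b ∷ [])
      ear = e-ax ∷ chain-join zs c (subst (λ t → Edge D t b) (sym last≡y) e-yb ∷ [])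
      earDistinct : Distinct (vtx i ∷ I ++ b ∷ [])
      earDistinct = a∉ , distinct-snoc I dist (λ m → off-C _ m (cycleSet⁺ b∈C))
        where
        a∉ : vtx i ∉ I ++ b ∷ []
        a∉ m with ∈-++⁻ I m
        ... | inj₁ m′       = off-C _ m′ (cycleSet⁺ (i , refl))
        ... | inj₂ (here e) = a≢b e

    chordless : ∀ i j → Edge D (vtx i) (vtx j) → Consec i j ⊎ Consec j i
    chordless i j e with consec? i j ⊎-dec consec? j i
    ... | yes c  = c
    ... | no ¬c  = ⊥-elim (no-third-neighbour cycleSet-nonseparable (λ v t → t) i (cycleSet⁺ (j , refl)) e
                      (λ e′ → ¬c (inj₁ (subst (Consec i) (sym (inj e′)) (proj₂ (successor i)))))
                      (λ e′ → ¬c (inj₂ (subst (λ t → Consec t i) (sym (inj e′)) (proj₂ (predecessor i))))))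

module PathList {n : ℕ} (D : Digraph n) (P : DPath D) where
  open Lists
  open Sequences
  open DPath P

  first : Fin n
  first = vtx zero

  rest : List (Fin n)
  rest = tailList len vtx

  arcChain : Chain (Arc D) first rest
  arcChain = seq-chain len vtx arcs

  edgeChain : Chain (Edge D) first rest
  edgeChain = chain-map inj₁ arcChain

  distinct : Distinct (first ∷ rest)
  distinct = seq-distinct len vtx inj

  on⁺ : ∀ {x} → OnPath D P x → x ∈ first ∷ rest
  on⁺ = seq-∈⁺ len vtx

  on⁻ : ∀ {x} → x ∈ first ∷ rest → OnPath D P x
  on⁻ = seq-∈⁻ len vtx

  arc⁺ : ∀ {x y} → PathArc D P x y → Adjacent x y (first ∷ rest)
  arc⁺ = seq-adjacent⁺ len vtx

  arc⁻ : ∀ {x y} → Adjacent x y (first ∷ rest) → PathArc D P x y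
  arc⁻ = seq-adjacent⁻ len vtx

  last≡end : lastOf first rest ≡ end D P
  last≡end = seq-last len vtx

  end≢start : 1 ≤ len → end D P ≢ start D P
  end≢start 1≤len e = ℕ.<⇒≢ 1≤len (trans (cong toℕ (inj (sym e))) (Fin.toℕ-fromℕ len))

module ListPath {n : ℕ} (D : Digraph n) (m : Fin n) (M : List (Fin n))
                (arcChain : Lists.Chain (Arc D) m M) (dist : Lists.Distinct (m ∷ M)) where
  open Lists
  open Sequences

  listPath : DPath D
  listPath = record { len = length M ; vtx = fromList m M ; inj = fromList-injective m M dist ; arcs = fromList-steps m M arcChain }

  private
    asSequence : ∀ {P : List (Fin n) → Set} → P M → P (tailList (length M) (fromList m M))
    asSequence {P} = subst P (sym (tailList-fromList m M))

    asList : ∀ {P : List (Fin n) → Set} → P (tailList (length M) (fromList m M)) → P M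
    asList {P} = subst P (tailList-fromList m M)

  on⁺ : ∀ {x} → x ∈ m ∷ M → OnPath D listPath x
  on⁺ {x} x∈ = seq-∈⁻ (length M) (fromList m M) (asSequence {λ t → x ∈ m ∷ t} x∈)

  on⁻ : ∀ {x} → OnPath D listPath x → x ∈ m ∷ M
  on⁻ (i , refl) = fromList-∈ m M i

  arc⁺ : ∀ {x y} → Adjacent x y (m ∷ M) → PathArc D listPath x y
  arc⁺ {x} {y} a = seq-adjacent⁻ (length M) (fromList m M) (asSequence {λ t → Adjacent x y (m ∷ t)} a)

  arc⁻ : ∀ {x y} → PathArc D listPath x y → Adjacent x y (m ∷ M)
  arc⁻ {x} {y} a = asList {λ t → Adjacent x y (m ∷ t)} (seq-adjacent⁺ (length M) (fromList m M) a)

  end≡last : end D listPath ≡ lastOf m M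
  end≡last = fromList-last m M (fromℕ (length M)) (Fin.toℕ-fromℕ (length M))

module PathEnds {n : ℕ} (D : Digraph n) (W W′ : DPath D)
                (vertices : ∀ x → OnPath D W′ x → OnPath D W x) (arcs : ∀ x y → PathArc D W x y → PathArc D W′ x y) where
  open Lists
  private
    module W  = PathList D W
    module W′ = PathList D W′

  same-start : start D W′ ≡ start D W
  same-start with ∈-predecessor (W.on⁺ (vertices _ (zero , refl)))
  ... | inj₁ e       = e
  ... | inj₂ (p , a) = ⊥-elim (head-has-no-predecessor W′.distinct (W′.arc⁺ (arcs p _ (W.arc⁻ a))))

  same-end : end D W′ ≡ end D W
  same-end with ∈-successor (W.on⁺ (vertices _ (fromℕ (DPath.len W′) , refl)))
  ... | inj₁ e       = trans e W.last≡end
  ... | inj₂ (s , a) = ⊥-elim (last-has-no-successor W′.distinct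
                                 (subst (λ z → Adjacent z s (W′.first ∷ W′.rest)) (sym W′.last≡end) (W′.arc⁺ (arcs _ s (W.arc⁻ a)))))

module Separation {n : ℕ} (D : Digraph n) where
  open Lists
  open Sequences
  open Walks D
  open DecMembership (_≟_ {n}) using (_∈?_)

  cycleFromList : ∀ h t → Chain (Edge D) h t → Edge D (lastOf h t) h → Distinct (h ∷ t) → 2 ≤ length t
    → Σ (Cycle D) λ C → OnCycle D C h
  cycleFromList h t c closing dist 2≤t =
    record { len = suc (length t) ; 3≤len = s≤s 2≤t ; vtx = fromList h t ; inj = fromList-injective h t dist ; edges = edges }
    , zero , refl
    where
    edges : ∀ i j → Consec i j → Edge D (fromList h t i) (fromList h t j)
    edges i j       (inj₁ e)          = fromList-consecutive h t c i j e
    edges i zero    (inj₂ (e , _))    = subst (λ z → Edge D z h) (sym (fromList-last h t i (ℕ.suc-injective e))) closing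
    edges i (suc j) (inj₂ (_ , ()))

  allBut : Fin n → VSet n
  allBut w = remove (λ _ → true) w

  allBut⁺ : ∀ {w z} → z ≢ w → T (allBut w z)
  allBut⁺ = remove⁺ {λ _ → true} tt

  cycle-through : ∀ {w p s} → p ≢ s → Edge D w p → Edge D s w → Walk D (allBut w) p s → Σ (Cycle D) λ C → OnCycle D C w
  cycle-through {w} {p} p≢s e-wp e-sw walk with walk→path walk
  ... | []       , c , last≡s , _    , _      = ⊥-elim (p≢s last≡s)
  ... | (z ∷ zs) , c , last≡s , dist , avoids =
    cycleFromList w (p ∷ z ∷ zs) (e-wp ∷ c) (subst (λ t → Edge D t w) (sym last≡s) e-sw)
                  ((λ m → proj₂ (remove⁻ {λ _ → true} (avoids _ m)) refl) , dist) (s≤s (s≤s z≤n))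

  -- If P* avoids an interior vertex w of P (same ends), the neighbours p, s of w on P are
  -- joined avoiding w: back along P from p to u, along P* to v, back along P from v to s.
  detour : ∀ {h w s} Y₁ Y₂ → Chain (Edge D) h Y₁ → Chain (Edge D) s Y₂
    → Distinct (h ∷ Y₁ ++ w ∷ s ∷ Y₂) → ∀ h* t* → Chain (Edge D) h* t* → w ∉ h* ∷ t*
    → h ≡ h* → lastOf s Y₂ ≡ lastOf h* t* → Walk D (allBut w) (lastOf h Y₁) s
  detour {h} {w} {s} Y₁ Y₂ c₁ c₂ dist h* t* c* w∉P* refl same-end =
    reverseʷ toU ++ʷ (alongP* ++ʷ reverseʷ toV)
    where
    toU : Walk D (allBut w) h (lastOf h Y₁)
    toU = chainWalk c₁ (λ z m → allBut⁺ (distinct-disjoint (h ∷ Y₁) dist m (here refl)))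
    alongP* : Walk D (allBut w) h (lastOf s Y₂)
    alongP* = subst (Walk D (allBut w) h) (sym same-end)
                    (chainWalk c* (λ z m → allBut⁺ (λ z≡w → w∉P* (subst (_∈ h ∷ t*) z≡w m))))
    toV : Walk D (allBut w) s (lastOf s Y₂)
    toV = chainWalk c₂ (λ z m → allBut⁺ (λ z≡w → proj₁ (distinct-++ʳ (h ∷ Y₁) dist) (subst (_∈ s ∷ Y₂) z≡w m)))

  missed-vertex-on-cycle : ∀ {w} h Y₁ Y₂ → Chain (Edge D) h (Y₁ ++ w ∷ Y₂) → Distinct (h ∷ Y₁ ++ w ∷ Y₂)
    → ∀ h* t* → Chain (Edge D) h* t* → w ∉ h* ∷ t* → h ≡ h* → lastOf h (Y₁ ++ w ∷ Y₂) ≡ lastOf h* t*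
    → Σ (Cycle D) λ C → OnCycle D C w
  missed-vertex-on-cycle h Y₁ [] c dist h* t* c* w∉P* same-start same-end =
    ⊥-elim (w∉P* (subst (_∈ h* ∷ t*) (trans (sym same-end) (lastOf-++ h Y₁ (_ ∷ []))) (lastOf-∈ h* t*)))
  missed-vertex-on-cycle {w} h Y₁ (s ∷ Y₂) c dist h* t* c* w∉P* same-start same-end with chain-split Y₁ c
  ... | c₁ , (e-pw ∷ e-ws ∷ c₂) =
    cycle-through p≢s (edge-sym e-pw) (edge-sym e-ws)
                  (detour Y₁ Y₂ c₁ c₂ dist h* t* c* w∉P* same-start (trans (sym (lastOf-++ h Y₁ (w ∷ s ∷ Y₂))) same-end))
    where
    p≢s : lastOf h Y₁ ≢ s
    p≢s = distinct-disjoint (h ∷ Y₁) dist (lastOf-∈ h Y₁) (there (here refl))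

  acyclic-vertex-unavoidable : (P P* : DPath D) → start D P ≡ start D P* → end D P ≡ end D P*
    → ∀ w → OnPath D P w → ((C : Cycle D) → ¬ OnCycle D C w) → OnPath D P* w
  acyclic-vertex-unavoidable P P* same-start same-end w w∈P acyclic with w ∈? (PathList.first D P* ∷ PathList.rest D P*)
  ... | yes w∈P* = PathList.on⁻ D P* w∈P*
  ... | no  w∉P* = ⊥-elim (missed (A.on⁺ w∈P))
    where
    module A = PathList D P
    module Q = PathList D P*
    same-last : lastOf A.first A.rest ≡ lastOf Q.first Q.rest
    same-last = trans A.last≡end (trans same-end (sym Q.last≡end))
    missed : w ∈ A.first ∷ A.rest → ⊥
    missed (here refl) = w∉P* (here same-start)
    missed (there m) with ∈-∃++ m
    ... | Y₁ , Y₂ , eq =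
      let C , w∈C = missed-vertex-on-cycle A.first Y₁ Y₂ (subst (Chain (Edge D) A.first) eq A.edgeChain)
                      (subst (λ t → Distinct (A.first ∷ t)) eq A.distinct) Q.first Q.rest Q.edgeChain w∉P* same-start
                      (subst (λ t → lastOf A.first t ≡ lastOf Q.first Q.rest) eq same-last)
      in acyclic C w∈C

module Meeting {n : ℕ} (D : Digraph n) (cactus : OrientedCactus D) (C : Cycle D) where
  open Lists
  open Walks D
  open Cycles D
  open Cycle C

  OffC OnC : List (Fin n) → Set
  OffC L = ∀ z → z ∈ L → ¬ T (cycleSet cactus C z)
  OnC  L = ∀ z → z ∈ L → T (cycleSet cactus C z)

  -- Entry u m: going from u, the cycle is first reached at m (u = m, or a walk from u avoiding C
  -- followed by one edge into m).
  Entry : Fin n → Fin n → Set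
  Entry u m = u ≡ m ⊎ Σ (Fin n) λ x → Walk D (OffCycle cactus C) u x × Edge D x m

  entry-via : ∀ {u v b} → Walk D (OffCycle cactus C) u v → T (cycleSet cactus C b) → Entry v b → Entry u b
  entry-via w b∈C (inj₁ refl)         = ⊥-elim (T-not⇒¬T (walk-end w) b∈C)
  entry-via w b∈C (inj₂ (x , w′ , e)) = inj₂ (x , w ++ʷ w′ , e)

  entry-step : ∀ {u y m} → ¬ T (cycleSet cactus C u) → Edge D u y → Entry y m → Entry u m
  entry-step u∉C e (inj₁ refl)         = inj₂ (_ , [ ¬T⇒T-not u∉C ] , e)
  entry-step u∉C e (inj₂ (x , w , e′)) = inj₂ (x , step (¬T⇒T-not u∉C) e w , e′)

  -- The first cycle vertex reached from u is unique (otherwise C would have a bypass).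
  entry-unique : ∀ {u a b} → OnCycle D C a → OnCycle D C b → Entry u a → Entry u b → b ≡ a
  entry-unique {u} {a} {b} a∈C b∈C ea eb with a ≟ b
  ... | yes a≡b = sym a≡b
  ... | no  a≢b with ea | eb
  ...   | inj₁ refl        | inj₁ refl          = refl
  ...   | inj₁ refl        | inj₂ (_ , w , _)   = ⊥-elim (T-not⇒¬T (walk-start w) (cycleSet⁺ cactus C a∈C))
  ...   | inj₂ (_ , w , _) | inj₁ refl          = ⊥-elim (T-not⇒¬T (walk-start w) (cycleSet⁺ cactus C b∈C))
  ...   | inj₂ (x , w , e) | inj₂ (x′ , w′ , e′) =
    ⊥-elim (no-bypass cactus C a∈C b∈C a≢b (edge-sym e) e′ (reverseʷ w ++ʷ w′))

  data FirstHit (u : Fin n) (ys : List (Fin n)) : Set where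
    hit : ∀ X m Z → u ∷ ys ≡ X ++ m ∷ Z → OffC X → T (cycleSet cactus C m) → Chain (Arc D) m Z → Entry u m
        → FirstHit u ys

  firstHit : ∀ u ys → Chain (Arc D) u ys → OffC (u ∷ ys) ⊎ FirstHit u ys
  firstHit u ys c with T? (cycleSet cactus C u)
  ... | yes u∈C = inj₂ (hit [] u ys refl (λ _ ()) u∈C c (inj₁ refl))
  firstHit u []       c       | no u∉C = inj₁ λ { z (here refl) → u∉C }
  firstHit u (y ∷ ys) (a ∷ c) | no u∉C with firstHit y ys c
  ... | inj₁ off = inj₁ λ { z (here refl) → u∉C ; z (there m) → off z m }
  ... | inj₂ (hit X m Z eq offX m∈C cZ entry) =
    inj₂ (hit (u ∷ X) m Z (cong (u ∷_) eq) off-uX m∈C cZ (entry-step u∉C (inj₁ a) entry))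
    where
    off-uX : OffC (u ∷ X)
    off-uX z (here refl) = u∉C
    off-uX z (there m)   = offX z m


  data Exit : List (Fin n) → Set where
    done  : Exit []
    leave : ∀ {y Y} → ¬ T (cycleSet cactus C y) → Exit (y ∷ Y)

  maximalRun : ∀ m Z → T (cycleSet cactus C m)
    → Σ (List (Fin n)) λ M → Σ (List (Fin n)) λ Y → Z ≡ M ++ Y × OnC (m ∷ M) × Exit Y
  maximalRun m []      m∈C = [] , [] , refl , (λ { _ (here refl) → m∈C }) , done
  maximalRun m (z ∷ Z) m∈C with T? (cycleSet cactus C z)
  ... | no  z∉C = [] , z ∷ Z , refl , (λ { _ (here refl) → m∈C }) , leave z∉C
  ... | yes z∈C with maximalRun z Z z∈C
  ...   | M , Y , refl , onM , exit = z ∷ M , Y , refl , (λ { _ (here refl) → m∈C ; x (there k) → onM x k }) , exit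

  -- After leaving C at ℓ an arc chain never comes back (that would be a bypass of C),
  -- so its last vertex reaches C first at ℓ.
  never-returns : ∀ {ℓ} Y → T (cycleSet cactus C ℓ) → Chain (Arc D) ℓ Y → Exit Y → ℓ ∉ Y
    → OffC Y × Entry (lastOf ℓ Y) ℓ
  never-returns []      _   _       done        _  = (λ _ ()) , inj₁ refl
  never-returns {ℓ} (y ∷ Y) ℓ∈C (a ∷ c) (leave y∉C) ℓ∉ with firstHit y Y c
  ... | inj₁ off = off , inj₂ (y , reverseʷ (chainWalk (chain-map inj₁ c) (λ z m → ¬T⇒T-not (off z m))) , inj₂ a)
  ... | inj₂ (hit X r _ eq _ r∈C _ entry) = ⊥-elim (returns entry)
    where
    ℓ≢r : ℓ ≢ r
    ℓ≢r ℓ≡r = ℓ∉ (subst (_∈ y ∷ Y) (sym ℓ≡r) (subst (r ∈_) (sym eq) (∈-++⁺ʳ X (here refl))))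
    returns : Entry y r → ⊥
    returns (inj₁ refl)        = y∉C r∈C
    returns (inj₂ (x , w , e)) = no-bypass cactus C (cycleSet⁻ cactus C ℓ∈C) (cycleSet⁻ cactus C r∈C) ℓ≢r (inj₁ a) e w

  record Decomposition (u : Fin n) (ys : List (Fin n)) : Set where
    constructor decomposition
    field
      before     : List (Fin n)
      enter      : Fin n
      run        : List (Fin n)
      after      : List (Fin n)
      split      : u ∷ ys ≡ before ++ enter ∷ run ++ after
      before-off : OffC before
      run-on     : OnC (enter ∷ run)
      after-off  : OffC after
      run-arcs   : Chain (Arc D) enter run
      enters     : Entry u enter
      exits      : Entry (lastOf u ys) (lastOf enter run)

  decompose : ∀ u ys → Chain (Arc D) u ys → Distinct (u ∷ ys) → OffC (u ∷ ys) ⊎ Decomposition u ys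
  decompose u ys c dist with firstHit u ys c
  ... | inj₁ off = inj₁ off
  ... | inj₂ (hit X m Z split offX m∈C cZ enters) with maximalRun m Z m∈C
  ...   | M , Y , refl , onM , exit with chain-split M cZ
  ...     | cM , cY with never-returns Y (onM _ (lastOf-∈ m M)) cY exit last∉Y
    where
    last∉Y : lastOf m M ∉ Y
    last∉Y ℓ∈Y = distinct-disjoint (m ∷ M) (distinct-++ʳ X (subst Distinct split dist)) (lastOf-∈ m M) ℓ∈Y refl
  ...       | offY , exits = inj₂ (decomposition X m M Y split offX onM offY cM enters
                                    (subst (λ z → Entry z (lastOf m M)) (sym last≡) exits))
    where
    last≡ : lastOf u ys ≡ lastOf (lastOf m M) Y
    last≡ = trans (lastOf-middle X split) (lastOf-++ m M Y)

  cycleArc-ends : ∀ {x y} → CycleArc D C x y → OnCycle D C x × OnCycle D C y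
  cycleArc-ends (_ , i , j , _ , inj₁ (e₁ , e₂)) = (i , e₁) , (j , e₂)
  cycleArc-ends (_ , i , j , _ , inj₂ (e₁ , e₂)) = (j , e₂) , (i , e₁)

  -- The run of a decomposed path P is exactly P ∩ C: its vertices are the common vertices,
  -- and its arcs are arcs of C because C is chordless.
  module Run (P : DPath D) (d : Decomposition (PathList.first D P) (PathList.rest D P)) where
    private module P = PathList D P
    open Decomposition d
    open Equivalence

    dist : Distinct (before ++ enter ∷ run ++ after)
    dist = subst Distinct split P.distinct

    runPath : DPath D
    runPath = ListPath.listPath D enter run run-arcs (distinct-++ˡ (enter ∷ run) (distinct-++ʳ before dist))

    private module R = ListPath D enter run run-arcs (distinct-++ˡ (enter ∷ run) (distinct-++ʳ before dist))

    runPath-end : end D runPath ≡ lastOf enter run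
    runPath-end = R.end≡last

    inPath : ∀ {x} → x ∈ enter ∷ run → OnPath D P x
    inPath m = P.on⁻ (subst (_ ∈_) (sym split) (∈-++⁺ʳ before (∈-++⁺ˡ m)))

    common-vertices : ∀ x → (OnPath D P x × OnCycle D C x) ⇔ OnPath D runPath x
    common-vertices x = mk⇔ common⇒run (λ x∈R → let m = R.on⁻ x∈R in inPath m , cycleSet⁻ cactus C (run-on x m))
      where
      common⇒run : OnPath D P x × OnCycle D C x → OnPath D runPath x
      common⇒run (x∈P , x∈C) with ∈-++⁻ before (subst (x ∈_) split (P.on⁺ x∈P))
      ... | inj₁ m = ⊥-elim (before-off x m (cycleSet⁺ cactus C x∈C))
      ... | inj₂ m with ∈-++⁻ (enter ∷ run) m
      ...   | inj₁ m′ = R.on⁺ m′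
      ...   | inj₂ m′ = ⊥-elim (after-off x m′ (cycleSet⁺ cactus C x∈C))

    common-arcs : ∀ x y → (PathArc D P x y × CycleArc D C x y) ⇔ PathArc D runPath x y
    common-arcs x y = mk⇔ common⇒run run⇒common
      where
      off : ∀ {z} → OnCycle D C z → ∀ {L} → OffC L → z ∉ L
      off z∈C offL z∈L = offL _ z∈L (cycleSet⁺ cactus C z∈C)
      common⇒run : PathArc D P x y × CycleArc D C x y → PathArc D runPath x y
      common⇒run (a , ca) with cycleArc-ends ca | adjacent-++⁻ before (subst (Adjacent x y) split (P.arc⁺ a))
      ... | x∈C , _   | inj₁ a′               = ⊥-elim (off x∈C before-off (adjacent-fst a′))
      ... | x∈C , _   | inj₂ (inj₂ (x∈ , _))  = ⊥-elim (off x∈C before-off x∈)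
      ... | x∈C , y∈C | inj₂ (inj₁ a′) with adjacent-++⁻ (enter ∷ run) a′
      ...   | inj₁ a″              = R.arc⁺ a″
      ...   | inj₂ (inj₁ a″)       = ⊥-elim (off x∈C after-off (adjacent-fst a″))
      ...   | inj₂ (inj₂ (_ , y∈)) = ⊥-elim (off y∈C after-off y∈)
      run⇒common : PathArc D runPath x y → PathArc D P x y × CycleArc D C x y
      run⇒common ra = P.arc⁻ (subst (Adjacent x y) (sym split) (adjacent-++ʳ before (adjacent-++ˡ after adj))) , arc , onC
        where
        adj : Adjacent x y (enter ∷ run)
        adj = R.arc⁻ ra
        arc : Arc D x y
        arc = adjacent-related run-arcs adj
        onC : ∃[ i ] ∃[ j ] (Consec i j × ((vtx i ≡ x × vtx j ≡ y) ⊎ (vtx i ≡ y × vtx j ≡ x)))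
        onC with cycleSet⁻ cactus C (run-on x (adjacent-fst adj)) | cycleSet⁻ cactus C (run-on y (adjacent-snd adj))
        ... | i , refl | j , refl with chordless cactus C i j (inj₁ arc)
        ...   | inj₁ c = i , j , c , inj₁ (refl , refl)
        ...   | inj₂ c = j , i , c , inj₂ (refl , refl)

    run-meet : MeetIs D P C runPath
    run-meet = common-vertices , common-arcs

  meet-ends : ∀ P W W′ → MeetIs D P C W → MeetIs D P C W′ → start D W′ ≡ start D W × end D W′ ≡ end D W
  meet-ends P W W′ (vW , aW) (vW′ , aW′) = same-start , same-end
    where
    open Equivalence
    open PathEnds D W W′ (λ x on → to (vW x) (from (vW′ x) on)) (λ x y a → to (aW′ x y) (from (aW x y) a))

  meet-ends-on-C : ∀ P W → MeetIs D P C W → OnCycle D C (start D W) × OnCycle D C (end D W)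
  meet-ends-on-C P W (vW , _) = proj₂ (Equivalence.from (vW _) (zero , refl)) , proj₂ (Equivalence.from (vW _) (fromℕ _ , refl))

  meet-entries : (P W : DPath D) → MeetIs D P C W → Decomposition (PathList.first D P) (PathList.rest D P)
    → Entry (start D P) (start D W) × Entry (end D P) (end D W)
  meet-entries P W meetW d =
    subst (Entry (start D P)) (proj₁ ends) enters ,
    subst₂ Entry (PathList.last≡end D P) (trans (sym (Run.runPath-end P d)) (proj₂ ends)) exits
    where
    open Decomposition d
    ends : start D (Run.runPath P d) ≡ start D W × end D (Run.runPath P d) ≡ end D W
    ends = meet-ends P W (Run.runPath P d) meetW (Run.run-meet P d)

  meet-transfer : (P P* W : DPath D) → start D P ≡ start D P* → end D P ≡ end D P* → 1 ≤ DPath.len W → MeetIs D P C W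
    → Σ (DPath D) λ Q → start D Q ≡ start D W × end D Q ≡ end D W × MeetIs D P* C Q
  meet-transfer P P* W same-start same-end 1≤len meetW =
    transfer (decompose A.first A.rest A.arcChain A.distinct) (decompose A*.first A*.rest A*.arcChain A*.distinct)
    where
    module A  = PathList D P
    module A* = PathList D P*
    Result : Set
    Result = Σ (DPath D) λ Q → start D Q ≡ start D W × end D Q ≡ end D W × MeetIs D P* C Q
    W-on-C : OnCycle D C (start D W) × OnCycle D C (end D W)
    W-on-C = meet-ends-on-C P W meetW
    W-entries : Decomposition A.first A.rest → Entry (start D P*) (start D W) × Entry (end D P*) (end D W)
    W-entries dP = let enters , exits = meet-entries P W meetW dP
                   in subst (λ z → Entry z _) same-start enters , subst (λ z → Entry z _) same-end exits
    transfer : OffC (A.first ∷ A.rest) ⊎ Decomposition A.first A.rest → OffC (A*.first ∷ A*.rest) ⊎ Decomposition A*.first A*.rest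
      → Result
    -- P meets C, since W is nonempty.
    transfer (inj₁ offP) _ =
      ⊥-elim (offP _ (A.on⁺ (proj₁ (Equivalence.from (proj₁ meetW _) (zero , refl)))) (cycleSet⁺ cactus C (proj₁ W-on-C)))
    -- Avoiding C, P* would make start W and end W ≠ start W both the first cycle vertex reached from u.
    transfer (inj₂ dP) (inj₁ offP*) =
      ⊥-elim (PathList.end≢start D W 1≤len
               (entry-unique (proj₁ W-on-C) (proj₂ W-on-C) (proj₁ (W-entries dP))
                             (entry-via walkP* (cycleSet⁺ cactus C (proj₂ W-on-C)) (proj₂ (W-entries dP)))))
      where
      walkP* : Walk D (OffCycle cactus C) (start D P*) (end D P*)
      walkP* = subst (Walk D _ _) A*.last≡end (chainWalk A*.edgeChain (λ z m → ¬T⇒T-not (offP* z m)))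
    -- Otherwise the run of P* is its meet with C, and its ends are the same first cycle vertices.
    transfer (inj₂ dP) (inj₂ dP*) = Run.runPath P* dP* , start≡ , end≡ , Run.run-meet P* dP*
      where
      run-on-C : OnCycle D C (start D (Run.runPath P* dP*)) × OnCycle D C (end D (Run.runPath P* dP*))
      run-on-C = meet-ends-on-C P* (Run.runPath P* dP*) (Run.run-meet P* dP*)
      run-entries : Entry (start D P*) (start D (Run.runPath P* dP*)) × Entry (end D P*) (end D (Run.runPath P* dP*))
      run-entries = meet-entries P* (Run.runPath P* dP*) (Run.run-meet P* dP*) dP*
      start≡ : start D (Run.runPath P* dP*) ≡ start D W
      start≡ = entry-unique (proj₁ W-on-C) (proj₁ run-on-C) (proj₁ (W-entries dP)) (proj₁ run-entries)
      end≡ : end D (Run.runPath P* dP*) ≡ end D W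
      end≡ = entry-unique (proj₂ W-on-C) (proj₂ run-on-C) (proj₂ (W-entries dP)) (proj₂ run-entries)

lemma15 : ∀ {n} (D : Digraph n) → OrientedCactus D
    → (C : Cycle D) (u v : Fin n) (P : DPath D) → start D P ≡ u → end D P ≡ v
    → ((w : Fin n) → OnPath D P w → ((C' : Cycle D) → ¬ OnCycle D C' w)
         → (P* : DPath D) → start D P* ≡ u → end D P* ≡ v → OnPath D P* w)
    × ((W : DPath D) → 1 ≤ DPath.len W → MeetIs D P C W
         → (P* : DPath D) → start D P* ≡ u → end D P* ≡ v
         → Σ (DPath D) (λ Q → start D Q ≡ start D W × end D Q ≡ end D W × MeetIs D P* C Q))
lemma15 D cactus C u v P P-from-u P-to-v =
  (λ w w∈P acyclic P* P*-from-u P*-to-v →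
     Separation.acyclic-vertex-unavoidable D P P* (common P-from-u P*-from-u) (common P-to-v P*-to-v) w w∈P acyclic) ,
  (λ W 1≤len meetW P* P*-from-u P*-to-v →
     Meeting.meet-transfer D cactus C P P* W (common P-from-u P*-from-u) (common P-to-v P*-to-v) 1≤len meetW)
  where
  common : ∀ {x y z : Fin _} → x ≡ z → y ≡ z → x ≡ y
  common x≡z y≡z = trans x≡z (sym y≡z)
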